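{- For any integers $n\ge 3$ and $a\ge b\ge 1$, we have $\mathsf{sep}(C_n,a,b)\ge a-b$, where $C_n$ is the cycle on $n$ vertices.
   Context: All graphs are finite and simple. For integers $a\ge b\ge 1$ and $c\ge 0$: an $a$-list assignment of a graph $G$ is a function $L$ assigning to each vertex $v$ a set $L(v)$ of exactly $a$ integers (colors). It is $c$-separating if $|L(u)\cap L(v)|\le c$ for every edge $uv$. An $(L,b)$-coloring of $G$ is a function $\varphi$ assigning to each vertex $v$ a set $\varphi(v)\subseteq L(v)$ with $|\varphi(v)|=b$ such that $\varphi(u)\cap\varphi(v)=\emptyset$ for every edge $uv$. $G$ is $(a,b,c)$-choosable if for every $c$-separating $a$-list assignment $L$ of $G$ there exists an $(L,b)$-coloring of $G$. The separation number is $\mathsf{sep}(G,a,b)=\max\{c\ge 0 : G \text{ is } (a,b,c)\text{ -choosable}\}$ (every graph is $(a,b,0)$-choosable, and $0\le \mathsf{sep}(G,a,b)\le a$). -}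

module Defs where

open import Data.Nat using (ℕ; zero; suc; _+_)
open import Data.Fin using (Fin; toℕ)
open import Data.Integer using (ℤ)
open import Data.Integer.Properties using () renaming (_≟_ to _≟ℤ_)
open import Data.List using (List; length; filter)
open import Data.List.Membership.Propositional using (_∈_)
open import Data.List.Membership.DecPropositional _≟ℤ_ using (_∈?_)
open import Data.List.Relation.Unary.Unique.Propositional using (Unique)
open import Data.List.Relation.Unary.All using (All)
open import Data.Product using (_×_; Σ)
open import Data.Sum using (_⊎_)
open import Data.Empty using (⊥)
open import Relation.Binary.PropositionalEquality using (_≡_)

record Graph : Set₁ where
  field
    n   : ℕ
    Adj : Fin n → Fin n → Set

-- The cycle C_n on vertices 0,…,n-1: i ~ j iff j ≡ i+1 or i ≡ j+1 (mod n)
-- (the closing edge joins n-1 and 0).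
CycleAdj : (n : ℕ) → Fin n → Fin n → Set
CycleAdj n i j =
  (suc (toℕ i) ≡ toℕ j) ⊎ (suc (toℕ j) ≡ toℕ i) ⊎
  ((suc (toℕ i) ≡ n) × (toℕ j ≡ 0)) ⊎ ((suc (toℕ j) ≡ n) × (toℕ i ≡ 0))

Cycle : ℕ → Graph
Cycle n = record { n = n ; Adj = CycleAdj n }

IsKSet : ℕ → List ℤ → Set
IsKSet k xs = Unique xs × length xs ≡ k

-- |A ∩ B| for duplicate-free lists
∣_∩_∣ : List ℤ → List ℤ → ℕ
∣ A ∩ B ∣ = length (filter (_∈? B) A)

module _ (G : Graph) where
  open Graph G

  IsListAssignment : ℕ → (Fin n → List ℤ) → Set
  IsListAssignment a L = ∀ v → IsKSet a (L v)

  IsSeparating : ℕ → (Fin n → List ℤ) → Set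
  IsSeparating c L = ∀ u v → Adj u v → ∣ L u ∩ L v ∣ Data.Nat.≤ c

  IsColoring : (Fin n → List ℤ) → ℕ → (Fin n → List ℤ) → Set
  IsColoring L b φ =
    (∀ v → IsKSet b (φ v)) ×
    (∀ v → All (_∈ L v) (φ v)) ×
    (∀ u v → Adj u v → ∀ x → x ∈ φ u → x ∈ φ v → ⊥)

  Choosable : ℕ → ℕ → ℕ → Set
  Choosable a b c =
    ∀ (L : Fin n → List ℤ) → IsListAssignment a L → IsSeparating c L →
    Σ (Fin n → List ℤ) (IsColoring L b)

module Submission where

open import Defs
open import Data.Nat using (ℕ; _≤_; _∸_)
open import Data.Product using (Σ; _×_)

open import Data.Nat using (suc; _+_; _<_; _<?_)
open import Data.Nat.Properties
open import Data.Fin using (Fin; toℕ; fromℕ<; zero)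
open import Data.Fin.Properties using (toℕ-fromℕ<; toℕ<n; toℕ-injective)
open import Data.Integer using (ℤ)
open import Data.Integer.Properties using () renaming (_≟_ to _≟ℤ_)
open import Data.List using (List; []; _∷_; length; filter; take)
open import Data.List.Properties using (length-take)
open import Data.List.Membership.Propositional using (_∈_; _∉_)
open import Data.List.Membership.DecPropositional _≟ℤ_ using (_∈?_)
open import Data.List.Membership.Propositional.Properties using (∈-filter⁻)
open import Data.List.Relation.Binary.Sublist.Propositional using (lookup)
open import Data.List.Relation.Binary.Sublist.Propositional.Properties using (take-⊆)
open import Data.List.Relation.Unary.All using (All; tabulate)
open import Data.List.Relation.Unary.Unique.Propositional.Properties using (take⁺; filter⁺)
open import Data.Product using (_,_; proj₁; proj₂)
open import Data.Sum using (_⊎_; inj₁; inj₂)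
open import Data.Empty using (⊥; ⊥-elim)
open import Function using (_∘_)
open import Relation.Nullary using (¬?; yes; no)
open import Relation.Unary using (Pred; Decidable)
open import Relation.Binary.PropositionalEquality

-- Orient every edge of C_n from i to i+1 (mod n).  Each vertex v keeps b colours of
-- L(v) that are absent from the list of its successor; there are at least b of them
-- because |L(v) ∩ L(succ v)| ≤ a − b.  Every edge joins some u to succ u, and the
-- colours of u avoid L(succ u) ⊇ φ(succ u), so the choice is proper.

length-filter-+-∁ : ∀ {a p} {A : Set a} {P : Pred A p} (P? : Decidable P) (xs : List A) →
  length (filter P? xs) + length (filter (¬? ∘ P?) xs) ≡ length xs
length-filter-+-∁ P? [] = refl
length-filter-+-∁ P? (x ∷ xs) with P? x
... | yes _ = cong suc (length-filter-+-∁ P? xs)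
... | no _  = trans (+-suc _ _) (cong suc (length-filter-+-∁ P? xs))

avoiding-subset : ∀ {a b} (A B : List ℤ) → IsKSet a A → b ≤ a → ∣ A ∩ B ∣ ≤ a ∸ b →
  Σ (List ℤ) λ S → IsKSet b S × (∀ {x} → x ∈ S → x ∈ A × x ∉ B)
avoiding-subset {a} {b} A B (uniqueA , ∣A∣≡a) b≤a sep =
  take b A∖B , (take⁺ b (filter⁺ _ uniqueA) , ∣S∣≡b) , ∈-filter⁻ ∉B? ∘ lookup (take-⊆ b A∖B)
  where
  ∉B? : Decidable (_∉ B)
  ∉B? x = ¬? (x ∈? B)
  A∖B : List ℤ
  A∖B = filter ∉B? A
  b≤∣A∖B∣ : b ≤ length A∖B
  b≤∣A∖B∣ = begin
    b                              ≡⟨ sym (m∸[m∸n]≡n b≤a) ⟩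
    a ∸ (a ∸ b)                    ≤⟨ ∸-monoʳ-≤ a sep ⟩
    a ∸ ∣ A ∩ B ∣                  ≡⟨ cong (_∸ ∣ A ∩ B ∣) (sym (trans (length-filter-+-∁ (_∈? B) A) ∣A∣≡a)) ⟩
    ∣ A ∩ B ∣ + length A∖B ∸ ∣ A ∩ B ∣ ≡⟨ m+n∸m≡n ∣ A ∩ B ∣ (length A∖B) ⟩
    length A∖B                     ∎
    where open ≤-Reasoning
  ∣S∣≡b : length (take b A∖B) ≡ b
  ∣S∣≡b = trans (length-take b A∖B) (m≤n⇒m⊓n≡m b≤∣A∖B∣)

record FunctionalOrientation (G : Graph) : Set where
  open Graph G
  field
    succ       : Fin n → Fin n
    adj-succ   : ∀ v → Adj v (succ v)
    succ-cover : ∀ {u v} → Adj u v → v ≡ succ u ⊎ u ≡ succ v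

module _ {G : Graph} (O : FunctionalOrientation G) where
  open Graph G
  open FunctionalOrientation O

  functionalOrientation⇒choosable : ∀ {a b} → b ≤ a → Choosable G a b (a ∸ b)
  functionalOrientation⇒choosable {a} {b} b≤a L isList sep = φ , isKSet , ⊆L , proper
    where
    avoid : ∀ v → Σ (List ℤ) λ S → IsKSet b S × (∀ {x} → x ∈ S → x ∈ L v × x ∉ L (succ v))
    avoid v = avoiding-subset (L v) (L (succ v)) (isList v) b≤a (sep v (succ v) (adj-succ v))
    φ : Fin n → List ℤ
    φ v = proj₁ (avoid v)
    isKSet : ∀ v → IsKSet b (φ v)
    isKSet v = proj₁ (proj₂ (avoid v))
    avoids : ∀ v {x} → x ∈ φ v → x ∈ L v × x ∉ L (succ v)
    avoids v = proj₂ (proj₂ (avoid v))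
    ⊆L : ∀ v → All (_∈ L v) (φ v)
    ⊆L v = tabulate (proj₁ ∘ avoids v)
    proper : ∀ u v → Adj u v → ∀ x → x ∈ φ u → x ∈ φ v → ⊥
    proper u v uv x x∈φu x∈φv with succ-cover uv
    ... | inj₁ refl = proj₂ (avoids u x∈φu) (proj₁ (avoids v x∈φv))
    ... | inj₂ refl = proj₂ (avoids v x∈φv) (proj₁ (avoids u x∈φu))

module _ (m : ℕ) where
  private
    n = suc m

  cycleSucc : Fin n → Fin n
  cycleSucc i with suc (toℕ i) <? n
  ... | yes i+1<n = fromℕ< i+1<n
  ... | no _      = zero

  cycleAdj-succ : ∀ i → CycleAdj n i (cycleSucc i)
  cycleAdj-succ i with suc (toℕ i) <? n
  ... | yes i+1<n = inj₁ (sym (toℕ-fromℕ< i+1<n))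
  ... | no i+1≮n  = inj₂ (inj₂ (inj₁ (≤-antisym (toℕ<n i) (≮⇒≥ i+1≮n) , refl)))

  forward-edge⇒cycleSucc : ∀ i j → (suc (toℕ i) ≡ toℕ j) ⊎ ((suc (toℕ i) ≡ n) × (toℕ j ≡ 0)) →
    j ≡ cycleSucc i
  forward-edge⇒cycleSucc i j edge with suc (toℕ i) <? n | edge
  ... | yes i+1<n | inj₁ i+1≡j      = toℕ-injective (trans (sym i+1≡j) (sym (toℕ-fromℕ< i+1<n)))
  ... | yes i+1<n | inj₂ (i+1≡n , _) = ⊥-elim (<-irrefl i+1≡n i+1<n)
  ... | no i+1≮n  | inj₁ i+1≡j      = ⊥-elim (i+1≮n (subst (_< n) (sym i+1≡j) (toℕ<n j)))
  ... | no _      | inj₂ (_ , j≡0)  = toℕ-injective j≡0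

  cycleOrientation : FunctionalOrientation (Cycle n)
  cycleOrientation = record
    { succ       = cycleSucc
    ; adj-succ   = cycleAdj-succ
    ; succ-cover = λ {i} {j} → cover i j
    }
    where
    cover : ∀ i j → CycleAdj n i j → j ≡ cycleSucc i ⊎ i ≡ cycleSucc j
    cover i j (inj₁ e)               = inj₁ (forward-edge⇒cycleSucc i j (inj₁ e))
    cover i j (inj₂ (inj₁ e))        = inj₂ (forward-edge⇒cycleSucc j i (inj₁ e))
    cover i j (inj₂ (inj₂ (inj₁ e))) = inj₁ (forward-edge⇒cycleSucc i j (inj₂ e))
    cover i j (inj₂ (inj₂ (inj₂ e))) = inj₂ (forward-edge⇒cycleSucc j i (inj₂ e))

proposition1 : (n a b : ℕ) → 3 ≤ n → b ≤ a → 1 ≤ b →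
    Σ ℕ (λ c → (a ∸ b ≤ c) × (c ≤ a) × Choosable (Cycle n) a b c)
proposition1 (suc m) a b _ b≤a _ =
  a ∸ b , ≤-refl , m∸n≤m a b , functionalOrientation⇒choosable (cycleOrientation m) b≤a
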